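{- Let $G$ be a graph, let $S \subseteq V(G)$, and let $H$ be a connected component of the induced subgraph $G[\langle S\rangle_{cc}]$, where $\langle S\rangle_{cc}$ denotes the cycle convex hull of $S$. Then $|S \cap V(H)| = 1$ if $H$ is trivial (a single vertex), and $|S \cap V(H)| \geq 2$ otherwise.
   Context: Cycle convexity: for a graph $G$ and $S\subseteq V(G)$, a vertex $v\notin S$ is in the cycle interval of $S$ if the induced subgraph $G[S\cup\{v\}]$ contains a cycle through $v$; the cycle interval $I_{cc}(S)$ consists of $S$ together with all such vertices. $S$ is cycle convex if $I_{cc}(S)=S$. The cycle convex hull $\langle S\rangle_{cc}$ is the smallest cycle convex set containing $S$. -}

module Defs where

open import Level using (0ℓ)
open import Data.Nat using (ℕ; _≤_)
open import Data.Fin using (Fin)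
open import Data.Fin.Subset using (Subset; _∈_; _∉_; _∪_; _⊆_; ⁅_⁆; Nonempty)
open import Data.List using (List; []; _∷_; _++_; length; [_])
open import Data.List.Relation.Unary.All using (All)
open import Data.List.Relation.Unary.Unique.Propositional using (Unique)
open import Data.List.Relation.Unary.Linked using (Linked)
open import Data.Product using (Σ; _×_)
open import Data.Sum using (_⊎_)
open import Relation.Binary.PropositionalEquality using (_≡_)
open import Relation.Nullary using (¬_)

record Graph (n : ℕ) : Set₁ where
  field
    Adj   : Fin n → Fin n → Set
    sym   : ∀ {u v} → Adj u v → Adj v u
    irrefl : ∀ {u} → ¬ Adj u u
open Graph public

module _ {n : ℕ} (G : Graph n) where

  -- G[T] contains a cycle through v: distinct vertices v, y₁, …, yₖ, w (k ≥ 0,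
  -- so length ≥ 3), all in T, consecutive ones adjacent, and w adjacent to v.
  CycleThrough : Subset n → Fin n → Set
  CycleThrough T v =
    Σ (List (Fin n)) λ ys → Σ (Fin n) λ w →
      let cyc = v ∷ ys ++ [ w ] in
      (1 ≤ length ys) ×
      Unique cyc ×
      All (_∈ T) cyc ×
      Linked (Adj G) cyc ×
      Adj G w v

  InCycleInterval : Subset n → Fin n → Set
  InCycleInterval S v = v ∈ S ⊎ (v ∉ S × CycleThrough (S ∪ ⁅ v ⁆) v)

  -- S is cycle convex: I_cc(S) = S (i.e. I_cc(S) ⊆ S; S ⊆ I_cc(S) always)
  CycleConvex : Subset n → Set
  CycleConvex S = ∀ v → InCycleInterval S v → v ∈ S

  IsCycleHull : Subset n → Subset n → Set
  IsCycleHull S T =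
    S ⊆ T × CycleConvex T × (∀ T′ → S ⊆ T′ → CycleConvex T′ → T ⊆ T′)

  data Reach (C : Subset n) : Fin n → Fin n → Set where
    here : ∀ {u} → u ∈ C → Reach C u u
    step : ∀ {u x w} → u ∈ C → Adj G u x → Reach C x w → Reach C u w

  IsComponent : Subset n → Subset n → Set
  IsComponent T C =
    C ⊆ T × Nonempty C ×
    (∀ {u w} → u ∈ C → w ∈ C → Reach C u w) ×
    (∀ {u w} → u ∈ C → w ∈ T → Adj G u w → w ∈ C)

{-# OPTIONS --safe #-}
-- If S meets C in at most one vertex, replace C inside T by S ∩ C. The resulting set
-- T[C ≔ S ∩ C] still contains S and is cycle convex: a vertex v outside it with a cycle
-- through v lies in T by convexity of T, hence in C, and its two cycle neighbours are
-- adjacent to C, hence are two distinct vertices of S ∩ C. Minimality of the hull then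
-- gives C ⊆ S, so |S ∩ C| = |C| ≥ 1.
module Submission where

open import Data.Nat using (zero; suc; _≤_; _<_; s≤s; z≤n)
open import Data.Nat.Properties using (≤-trans; ≤-antisym; <-≤-trans; ≤⇒≯)
open import Data.Fin using (Fin)
open import Data.Fin.Subset using (Subset; _∈_; _⊆_; _∩_; _∪_; ∁; ⁅_⁆; ∣_∣)
open import Data.Fin.Subset.Properties
  using (_∈?_; x∈p∩q⁺; x∈p∩q⁻; x∈p∪q⁺; x∈p∪q⁻; x∈⁅y⁆⇒x≡y; x∈∁p⇒x∉p; x∉p⇒x∈∁p;
         ∣⁅x⁆∣≡1; p⊆q⇒∣p∣≤∣q∣; ∣p∩q∣≤∣q∣; p∩q⊆q; x∈p∧x≢y⇒x∈p-y; x∈p⇒∣p-x∣<∣p∣)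
open import Data.List using ([]; _∷_)
open import Data.List.Relation.Unary.All as All using (_∷_)
open import Data.List.Relation.Unary.All.Properties using (∷ʳ⁻)
open import Data.List.Relation.Unary.AllPairs using (_∷_)
open import Data.List.Relation.Unary.Linked using (_∷_)
open import Data.Product using (_×_; _,_; proj₁; proj₂; ∃₂)
open import Data.Sum using (inj₁; inj₂)
open import Data.Empty using (⊥-elim)
open import Relation.Binary.PropositionalEquality using (_≡_; _≢_; refl; sym; subst)
open import Relation.Nullary using (yes; no)
open import Function using (_∘_)

open import Defs hiding (sym)

x∈p⇒1≤∣p∣ : ∀ {n} {p : Subset n} {x} → x ∈ p → 1 ≤ ∣ p ∣
x∈p⇒1≤∣p∣ {p = p} {x} x∈p = subst (_≤ ∣ p ∣) (∣⁅x⁆∣≡1 x)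
  (p⊆q⇒∣p∣≤∣q∣ λ y∈⁅x⁆ → subst (_∈ p) (sym (x∈⁅y⁆⇒x≡y x y∈⁅x⁆)) x∈p)

x∈p∧y∈p∧x≢y⇒2≤∣p∣ : ∀ {n} {p : Subset n} {x y} → x ∈ p → y ∈ p → x ≢ y → 2 ≤ ∣ p ∣
x∈p∧y∈p∧x≢y⇒2≤∣p∣ x∈p y∈p x≢y =
  <-≤-trans (s≤s (x∈p⇒1≤∣p∣ (x∈p∧x≢y⇒x∈p-y y∈p (x≢y ∘ sym)))) (x∈p⇒∣p-x∣<∣p∣ x∈p)

x∈p∪⁅y⁆∧y≢x⇒x∈p : ∀ {n} {p : Subset n} {x y} → x ∈ p ∪ ⁅ y ⁆ → y ≢ x → x ∈ p
x∈p∪⁅y⁆∧y≢x⇒x∈p {p = p} {y = y} x∈ y≢x with x∈p∪q⁻ p ⁅ y ⁆ x∈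
... | inj₁ x∈p = x∈p
... | inj₂ x∈⁅y⁆ = ⊥-elim (y≢x (sym (x∈⁅y⁆⇒x≡y y x∈⁅y⁆)))

one-or-at-least-two : ∀ {a c} → a ≤ c → 1 ≤ c → (a < 2 → c ≤ a) →
  (c ≡ 1 → a ≡ 1) × (c ≢ 1 → 2 ≤ a)
one-or-at-least-two {zero} _ 1≤c few with ≤-trans 1≤c (few (s≤s z≤n))
... | ()
one-or-at-least-two {suc zero} _ 1≤c few =
  (λ _ → refl) , λ c≢1 → ⊥-elim (c≢1 (≤-antisym (few (s≤s (s≤s z≤n))) 1≤c))
one-or-at-least-two {suc (suc _)} a≤c _ _ =
  (λ { refl → ⊥-elim (≤⇒≯ a≤c (s≤s (s≤s z≤n))) }) , λ _ → s≤s (s≤s z≤n)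

_[_≔_] : ∀ {n} → Subset n → Subset n → Subset n → Subset n
T [ C ≔ A ] = (T ∩ ∁ C) ∪ A

p⊆q⇒p⊆q[r≔p∩r] : ∀ {n} {p q : Subset n} (r : Subset n) → p ⊆ q → p ⊆ q [ r ≔ p ∩ r ]
p⊆q⇒p⊆q[r≔p∩r] r p⊆q {x} x∈p with x ∈? r
... | yes x∈r = x∈p∪q⁺ (inj₂ (x∈p∩q⁺ (x∈p , x∈r)))
... | no x∉r = x∈p∪q⁺ (inj₁ (x∈p∩q⁺ (p⊆q x∈p , x∉p⇒x∈∁p x∉r)))

module _ {n} (G : Graph n) where

  NeighbourClosed : Subset n → Subset n → Set
  NeighbourClosed T C = ∀ {u w} → u ∈ C → w ∈ T → Adj G u w → w ∈ C

  NeighbourIn : Subset n → Fin n → Fin n → Set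
  NeighbourIn T v y = v ≢ y × y ∈ T × Adj G v y

  cycle⇒two-neighbours : ∀ {T v} → CycleThrough G T v →
    ∃₂ λ y w → y ≢ w × NeighbourIn T v y × NeighbourIn T v w
  cycle⇒two-neighbours ([] , _ , () , _)
  cycle⇒two-neighbours (y ∷ ys , w , _ , (v≢y ∷ v≢rest) ∷ (y≢rest ∷ _) ,
                        _ ∷ y∈T ∷ rest∈T , v~y ∷ _ , w~v) =
    y , w , proj₂ (∷ʳ⁻ y≢rest) ,
    (v≢y , y∈T , v~y) , (proj₂ (∷ʳ⁻ v≢rest) , proj₂ (∷ʳ⁻ rest∈T) , Graph.sym G w~v)

  CycleThrough-mono : ∀ {T U v} → T ⊆ U → CycleThrough G T v → CycleThrough G U v
  CycleThrough-mono T⊆U (ys , w , len , uniq , ∈T , linked , w~v) =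
    ys , w , len , uniq , All.map T⊆U ∈T , linked , w~v

  cycle-convex-absorbs : ∀ {T U v} → CycleConvex G T → U ⊆ T →
    CycleThrough G (U ∪ ⁅ v ⁆) v → v ∈ T
  cycle-convex-absorbs {T} {U} {v} T-convex U⊆T cyc with v ∈? T
  ... | yes v∈T = v∈T
  ... | no v∉T = T-convex v (inj₂ (v∉T , CycleThrough-mono widen cyc))
    where
    widen : U ∪ ⁅ v ⁆ ⊆ T ∪ ⁅ v ⁆
    widen x∈ with x∈p∪q⁻ U ⁅ v ⁆ x∈
    ... | inj₁ x∈U = x∈p∪q⁺ (inj₁ (U⊆T x∈U))
    ... | inj₂ x∈⁅v⁆ = x∈p∪q⁺ (inj₂ x∈⁅v⁆)

  module Replacement {T C A : Subset n} (T-convex : CycleConvex G T) (C⊆T : C ⊆ T)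
           (C-closed : NeighbourClosed T C) (A⊆C : A ⊆ C) where

    T[C≔A]⊆T : T [ C ≔ A ] ⊆ T
    T[C≔A]⊆T x∈ with x∈p∪q⁻ (T ∩ ∁ C) A x∈
    ... | inj₁ x∈T∖C = proj₁ (x∈p∩q⁻ T (∁ C) x∈T∖C)
    ... | inj₂ x∈A = C⊆T (A⊆C x∈A)

    T[C≔A]∩C⊆A : ∀ {x} → x ∈ T [ C ≔ A ] → x ∈ C → x ∈ A
    T[C≔A]∩C⊆A x∈ x∈C with x∈p∪q⁻ (T ∩ ∁ C) A x∈
    ... | inj₁ x∈T∖C = ⊥-elim (x∈∁p⇒x∉p (proj₂ (x∈p∩q⁻ T (∁ C) x∈T∖C)) x∈C)
    ... | inj₂ x∈A = x∈A

    replace-component-convex : ∣ A ∣ < 2 → CycleConvex G (T [ C ≔ A ])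
    replace-component-convex _ v (inj₁ v∈) = v∈
    replace-component-convex ∣A∣<2 v (inj₂ (v∉ , cyc))
      with cycle⇒two-neighbours cyc
    ... | y , w , y≢w , y-nb , w-nb =
      ⊥-elim (≤⇒≯ (x∈p∧y∈p∧x≢y⇒2≤∣p∣ (nb∈A y-nb) (nb∈A w-nb) y≢w) ∣A∣<2)
      where
      v∈C : v ∈ C
      v∈C with v ∈? C
      ... | yes v∈C = v∈C
      ... | no v∉C = ⊥-elim (v∉ (x∈p∪q⁺ (inj₁ (x∈p∩q⁺ (v∈T , x∉p⇒x∈∁p v∉C)))))
        where
        v∈T : v ∈ T
        v∈T = cycle-convex-absorbs T-convex T[C≔A]⊆T cyc

      nb∈A : ∀ {x} → NeighbourIn (T [ C ≔ A ] ∪ ⁅ v ⁆) v x → x ∈ A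
      nb∈A {x} (v≢x , x∈ , v~x) = T[C≔A]∩C⊆A x∈T[C≔A] (C-closed v∈C (T[C≔A]⊆T x∈T[C≔A]) v~x)
        where
        x∈T[C≔A] : x ∈ T [ C ≔ A ]
        x∈T[C≔A] = x∈p∪⁅y⁆∧y≢x⇒x∈p x∈ v≢x

  ∣S∩C∣<2⇒C⊆S : ∀ {S T C} → IsCycleHull G S T → C ⊆ T → NeighbourClosed T C →
    ∣ S ∩ C ∣ < 2 → C ⊆ S
  ∣S∩C∣<2⇒C⊆S {S} {T} {C} (S⊆T , T-convex , T-least) C⊆T C-closed few {x} x∈C =
    proj₁ (x∈p∩q⁻ S C (T[C≔A]∩C⊆A x∈T[C≔S∩C] x∈C))
    where
    open Replacement T-convex C⊆T C-closed (p∩q⊆q S C)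
    x∈T[C≔S∩C] : x ∈ T [ C ≔ S ∩ C ]
    x∈T[C≔S∩C] = T-least _ (p⊆q⇒p⊆q[r≔p∩r] C S⊆T) (replace-component-convex few) (C⊆T x∈C)

proposition1 : ∀ {n} (G : Graph n) (S T C : Subset n) →
    IsCycleHull G S T → IsComponent G T C →
    (∣ C ∣ ≡ 1 → ∣ S ∩ C ∣ ≡ 1) × (∣ C ∣ ≢ 1 → 2 ≤ ∣ S ∩ C ∣)
proposition1 G S T C hull (C⊆T , (_ , x∈C) , _ , C-closed) =
  one-or-at-least-two (∣p∩q∣≤∣q∣ S C) (x∈p⇒1≤∣p∣ x∈C) λ few →
    p⊆q⇒∣p∣≤∣q∣ λ y∈C → x∈p∩q⁺ (∣S∩C∣<2⇒C⊆S G hull C⊆T C-closed few y∈C , y∈C)
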